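{- Let $G$ be a finite simple graph and $B\subseteq V(G)$. Then \[ \alpha_B(G)\le -\frac{1}{\zeta_G(B;1)}. \]
   Context: $C_B(G;x,y)=\sum_{K} x^{|K|}y^{|K\cap B|}$, summed over all cliques $K\subseteq V(G)$ (including the empty one). $\zeta_G(B;1)=\max\{z<0: C_B(G;z,1)=0\}$ (largest negative root in $x$; $-\infty$ if none). A set $I\subseteq B$ is $B$-independent if no two vertices of $I$ are adjacent in $G$; $\alpha_B(G)$ is the maximum size of a $B$-independent set. -}

module Defs where

open import Data.Bool using (Bool; true; false; _∧_; not; if_then_else_)
open import Data.Nat as ℕ using (ℕ; zero; suc)
open import Data.Integer using (ℤ; +_; -[1+_])
open import Data.Fin using (Fin)
open import Data.Fin.Subset renaming (∣_∣ to size) using (Subset; _∩_; inside; outside)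
open import Data.Vec using (Vec; []; _∷_; lookup)
open import Data.List using (List; []; _∷_; _++_; map; filter; foldr)
open import Data.Product using (Σ; _×_; _,_; ∃)
open import Relation.Binary.PropositionalEquality using (_≡_)
open import Relation.Nullary.Decidable using (does)
open import Data.Bool.Properties using (T?)
open import Data.Rational using (ℚ; 0ℚ; 1ℚ; _+_; _*_; _-_; -_; ∣_∣; _≤_; _<_; _/_)

record SimpleGraph (n : ℕ) : Set where
  field
    adj     : Fin n → Fin n → Bool
    sym     : ∀ u v → adj u v ≡ adj v u
    irrefl  : ∀ v → adj v v ≡ false
open SimpleGraph public

allSubsets : (n : ℕ) → List (Subset n)
allSubsets zero    = [] ∷ []
allSubsets (suc n) = map (outside ∷_) (allSubsets n) ++ map (inside ∷_) (allSubsets n)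

allFin : (n : ℕ) → (Fin n → Bool) → Bool
allFin zero    f = true
allFin (suc n) f = f Fin.zero ∧ allFin n (λ i → f (Fin.suc i))

-- K is a clique: any two distinct vertices of K are adjacent.
-- (adj is irreflexive, so we test u ≢ v explicitly.)
isClique : ∀ {n} → SimpleGraph n → Subset n → Bool
isClique {n} G K =
  allFin n λ u → allFin n λ v →
    if lookup K u ∧ lookup K v ∧ not (does (u Data.Fin.≟ v))
    then adj G u v else true

isBIndependent : ∀ {n} → SimpleGraph n → Subset n → Subset n → Bool
isBIndependent {n} G B I =
  allFin n (λ u → if lookup I u then lookup B u else true) ∧
  (allFin n λ u → allFin n λ v →
    if lookup I u ∧ lookup I v then not (adj G u v) else true)

alphaB : ∀ {n} → SimpleGraph n → Subset n → ℕ
alphaB {n} G B =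
  foldr (λ I m → ℕ._⊔_ (if isBIndependent G B I then size I else 0) m) 0 (allSubsets n)

_^ℚ_ : ℚ → ℕ → ℚ
x ^ℚ zero  = 1ℚ
x ^ℚ suc k = x * (x ^ℚ k)

-- C_B(G;x,y) = Σ_{K clique} x^|K| y^|K ∩ B|  (empty clique included).
cliquePoly : ∀ {n} → SimpleGraph n → Subset n → ℚ → ℚ → ℚ
cliquePoly {n} G B x y =
  foldr (λ K s → (if isClique G K then (x ^ℚ size K) * (y ^ℚ size (K ∩ B)) else 0ℚ) + s)
        0ℚ (allSubsets n)

inv-suc : ℕ → ℚ
inv-suc k = + 1 / suc k

-- -1/a for a ≥ 1 (value at 0 is irrelevant and never used).
negRecip : ℕ → ℚ
negRecip zero    = 0ℚ
negRecip (suc k) = -[1+ 0 ] / suc k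

-- A real number ρ, given as a regular Cauchy sequence of rationals
-- (|s m - s n| ≤ 1/(m+1) + 1/(n+1)), such that
--   * ρ is a root of p (p(s n) → 0; p is a polynomial, hence continuous),
--   * ρ is negative (s n ≤ -δ for a fixed rational δ > 0),
--   * ρ ≥ a (a ≤ s n for all n).
-- i.e. "p has a real root ρ with a ≤ ρ < 0".
record NegativeRootAbove (p : ℚ → ℚ) (a : ℚ) : Set where
  field
    s        : ℕ → ℚ
    regular  : ∀ m k → ∣ s m - s k ∣ ≤ inv-suc m + inv-suc k
    root     : ∀ (ε : ℚ) → 0ℚ < ε → ∃ λ N → ∀ k → N ℕ.≤ k → ∣ p (s k) ∣ ≤ ε
    δ        : ℚ
    δ-pos    : 0ℚ < δ
    negative : ∀ k → s k ≤ - δ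
    above    : ∀ k → a ≤ s k

-- Write Q_W(x) for C(G[W]; x, 1), the clique polynomial of the subgraph induced by W.
-- Splitting the cliques of G[W] on whether they contain a vertex v gives
-- Q_W = Q_{W-v} + x Q_{W ∩ N(v)}, so at any x ≤ 0 where every Q_W is positive, Q_W
-- decreases as W grows; in particular Q_V(x) ≤ Q_W(x) for every W. A B-independent set
-- of size α has Q_I(x) = 1 + α x, which vanishes at -1/α. Bisect [-1/α, 0] for the
-- decidable property that some Q_W(x) is ≤ 0, which holds at -1/α and fails at 0.
-- At the lower ends some Q_W is nonpositive while at the upper ends all Q_W are positive,
-- so monotonicity in W and a Lipschitz constant L for all Q_W on [-1, 1] force Q_V to
-- tend to 0 along the lower ends, which form the required Cauchy sequence. As Q_W(0) = 1,
-- the same Lipschitz bound keeps them at distance at least 1/(L + 1) from 0.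
module Submission where

open import Defs
open import Data.Bool using (Bool; true; false; _∧_; not; if_then_else_)
open import Data.Bool.Properties
  using (not-injective; ∧-comm; ∧-identityʳ; ∧-conicalˡ; ∧-conicalʳ; if-cong; if-cong-then; if-eta)
open import Data.Bool.Solver using (module ∨-∧-Solver)
open import Data.Empty using (⊥-elim)
open import Data.Fin using (Fin; zero; suc; _≟_)
open import Data.Fin.Subset renaming (∣_∣ to size)
  using (Subset; inside; outside; _∩_; _─_; ⁅_⁆; ⊤; ⊥; _∈_; _∉_; _⊆_; _⊂_)
open import Data.Fin.Subset.Induction using (⊂-wellFounded)
open import Data.Fin.Subset.Properties
  using (p─⊥≡p; ∩-assoc; ∩-comm; x∈p∩q⁺; x∈p∩q⁻; drop-there; p─q⊆p; x∈p∧x∉q⇒x∈p─q;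
         x∈p∧x≢y⇒x∈p-y; x∈p⇒p-x⊂p; nonempty?; _∈?_; ⊆-antisym; Empty-unique; ⊆⊤; anySubset?)
import Data.Integer as ℤ
import Data.Integer.Properties as ℤ
open import Data.List using (List; []; _∷_; _++_; map; foldr)
open import Data.Nat as ℕ using (ℕ; zero; suc)
import Data.Nat.Properties as ℕ
open import Data.Nat.Coprimality using (1-coprimeTo)
open import Data.Product using (∃; _×_; _,_; proj₁; proj₂)
open import Data.Rational
  using (ℚ; mkℚ; 0ℚ; 1ℚ; ½; _+_; _*_; _-_; -_; ∣_∣; _≤_; _<_; *≤*; NonNegative; nonNegative; positive)
open import Data.Rational.Literals using (fromℤ)
import Data.Rational.Properties as ℚ
open import Data.Rational.Solver using (module +-*-Solver)
import Data.Rational.Unnormalised as ℚᵘ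
import Data.Rational.Unnormalised.Properties as ℚᵘ
open import Data.Sum using (inj₁; inj₂)
open import Data.Vec using ([]; _∷_; here; there; lookup; tabulate; tail)
open import Data.Vec.Properties
  using (lookup∘tabulate; lookup-zipWith; lookup-replicate; []=⇒lookup; lookup⇒[]=)
open import Function using (_∘_)
open import Induction.WellFounded using (Acc; acc)
open import Relation.Binary.PropositionalEquality as ≡
  using (_≡_; _≢_; refl; cong; cong₂; module ≡-Reasoning)
open import Relation.Nullary using (¬_; yes; no; Dec)
open import Relation.Nullary.Decidable using (does; dec-false)
open import Relation.Unary using (Decidable)

allFin-cong : ∀ n {f g : Fin n → Bool} → (∀ i → f i ≡ g i) → allFin n f ≡ allFin n g
allFin-cong zero    f≗g = refl
allFin-cong (suc n) f≗g = cong₂ _∧_ (f≗g zero) (allFin-cong n (λ i → f≗g (suc i)))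

allFin-true : ∀ n → allFin n (λ _ → true) ≡ true
allFin-true zero    = refl
allFin-true (suc n) = allFin-true n

allFin-∧ : ∀ n (f g : Fin n → Bool) → allFin n (λ i → f i ∧ g i) ≡ allFin n f ∧ allFin n g
allFin-∧ zero    f g = refl
allFin-∧ (suc n) f g = begin
  (f zero ∧ g zero) ∧ allFin n (λ i → f (suc i) ∧ g (suc i))
    ≡⟨ cong ((f zero ∧ g zero) ∧_) (allFin-∧ n (λ i → f (suc i)) (λ i → g (suc i))) ⟩
  (f zero ∧ g zero) ∧ (allFin n (λ i → f (suc i)) ∧ allFin n (λ i → g (suc i)))
    ≡⟨ solve 4 (λ a b c d → (a :* b) :* (c :* d) := (a :* c) :* (b :* d)) refl (f zero) (g zero) _ _ ⟩
  (f zero ∧ allFin n (λ i → f (suc i))) ∧ (g zero ∧ allFin n (λ i → g (suc i))) ∎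
  where
  open ≡-Reasoning
  open ∨-∧-Solver

allFin-elim : ∀ n {f : Fin n → Bool} → allFin n f ≡ true → ∀ i → f i ≡ true
allFin-elim (suc n) all zero    = ∧-conicalˡ _ _ all
allFin-elim (suc n) all (suc i) = allFin-elim n (∧-conicalʳ _ _ all) i

if-∧-distrib : ∀ b c d → (if b then c ∧ d else true) ≡ (if b then c else true) ∧ (if b then d else true)
if-∧-distrib true  c d = refl
if-∧-distrib false c d = refl

─-∩ : ∀ {n} (p q r : Subset n) → (p ─ q) ∩ r ≡ (p ∩ r) ─ q
─-∩ []      []            []      = refl
─-∩ (x ∷ p) (outside ∷ q) (z ∷ r) = cong (x ∧ z ∷_) (─-∩ p q r)
─-∩ (x ∷ p) (inside  ∷ q) (z ∷ r) = cong (outside ∷_) (─-∩ p q r)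

∩-∩-comm : ∀ {n} (p q r : Subset n) → (p ∩ q) ∩ r ≡ (p ∩ r) ∩ q
∩-∩-comm p q r = begin
  (p ∩ q) ∩ r ≡⟨ ∩-assoc p q r ⟩
  p ∩ (q ∩ r) ≡⟨ cong (p ∩_) (∩-comm q r) ⟩
  p ∩ (r ∩ q) ≡⟨ ≡.sym (∩-assoc p r q) ⟩
  (p ∩ r) ∩ q ∎
  where open ≡-Reasoning

x∉p⇒p─⁅x⁆≡p : ∀ {n} {x : Fin n} {p} → x ∉ p → p ─ ⁅ x ⁆ ≡ p
x∉p⇒p─⁅x⁆≡p {x = zero}  {outside ∷ p} x∉p = cong (outside ∷_) (p─⊥≡p p)
x∉p⇒p─⁅x⁆≡p {x = zero}  {inside  ∷ p} x∉p = ⊥-elim (x∉p here)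
x∉p⇒p─⁅x⁆≡p {x = suc x} {b       ∷ p} x∉p = cong (b ∷_) (x∉p⇒p─⁅x⁆≡p (x∉p ∘ there))

x∈p─q⇒x∉q : ∀ {n} {x : Fin n} (p q : Subset n) → x ∈ p ─ q → x ∉ q
x∈p─q⇒x∉q (_ ∷ p) (outside ∷ q) (there x∈p─q) (there x∈q) = x∈p─q⇒x∉q p q x∈p─q x∈q
x∈p─q⇒x∉q (_ ∷ p) (inside  ∷ q) (there x∈p─q) (there x∈q) = x∈p─q⇒x∉q p q x∈p─q x∈q

-- Rational arithmetic

sumOver : ∀ {X : Set} → (X → ℚ) → List X → ℚ
sumOver f = foldr (λ x s → f x + s) 0ℚ

module _ {X : Set} where

  sumOver-++ : ∀ (f : X → ℚ) xs ys → sumOver f (xs ++ ys) ≡ sumOver f xs + sumOver f ys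
  sumOver-++ f []       ys = ≡.sym (ℚ.+-identityˡ _)
  sumOver-++ f (x ∷ xs) ys =
    ≡.trans (cong (f x +_) (sumOver-++ f xs ys)) (≡.sym (ℚ.+-assoc (f x) _ _))

  sumOver-map : ∀ {Y : Set} (f : X → ℚ) (g : Y → X) ys → sumOver f (map g ys) ≡ sumOver (f ∘ g) ys
  sumOver-map f g []       = refl
  sumOver-map f g (y ∷ ys) = cong (f (g y) +_) (sumOver-map f g ys)

  sumOver-cong : ∀ {f g : X → ℚ} → (∀ x → f x ≡ g x) → ∀ xs → sumOver f xs ≡ sumOver g xs
  sumOver-cong f≗g []       = refl
  sumOver-cong f≗g (x ∷ xs) = cong₂ _+_ (f≗g x) (sumOver-cong f≗g xs)

  sumOver-*ˡ : ∀ c (f : X → ℚ) xs → sumOver (λ x → c * f x) xs ≡ c * sumOver f xs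
  sumOver-*ˡ c f []       = ≡.sym (ℚ.*-zeroʳ c)
  sumOver-*ˡ c f (x ∷ xs) =
    ≡.trans (cong (c * f x +_) (sumOver-*ˡ c f xs)) (≡.sym (ℚ.*-distribˡ-+ c (f x) _))

  sumOver-0 : ∀ xs → sumOver (λ (_ : X) → 0ℚ) xs ≡ 0ℚ
  sumOver-0 []       = refl
  sumOver-0 (x ∷ xs) = ≡.trans (ℚ.+-identityˡ _) (sumOver-0 xs)

1^ℚk≡1 : ∀ k → 1ℚ ^ℚ k ≡ 1ℚ
1^ℚk≡1 zero    = refl
1^ℚk≡1 (suc k) = cong (1ℚ *_) (1^ℚk≡1 k)

p≤p+q : ∀ p {q} → 0ℚ ≤ q → p ≤ p + q
p≤p+q p 0≤q = ℚ.≤-trans (ℚ.≤-reflexive (≡.sym (ℚ.+-identityʳ p))) (ℚ.+-monoʳ-≤ p 0≤q)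

p≤q⇒0≤q-p : ∀ {p q} → p ≤ q → 0ℚ ≤ q - p
p≤q⇒0≤q-p {p} p≤q = ℚ.≤-trans (ℚ.≤-reflexive (≡.sym (ℚ.+-inverseʳ p))) (ℚ.+-monoˡ-≤ (- p) p≤q)

0≤q-p⇒p≤q : ∀ {p q} → 0ℚ ≤ q - p → p ≤ q
0≤q-p⇒p≤q {p} {q} 0≤q-p = begin
  p             ≡⟨ ≡.sym (ℚ.+-identityˡ p) ⟩
  0ℚ + p        ≤⟨ ℚ.+-monoˡ-≤ p 0≤q-p ⟩
  (q - p) + p   ≡⟨ solve 2 (λ p q → (q :- p) :+ p := q) refl p q ⟩
  q             ∎
  where
  open ℚ.≤-Reasoning
  open +-*-Solver

p≤∣p∣ : ∀ p → p ≤ ∣ p ∣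
p≤∣p∣ p@(mkℚ (ℤ.+_ _)    _ _) = ℚ.≤-refl
p≤∣p∣ p@(mkℚ ℤ.-[1+ _ ] _ _) = ℚ.≤-trans (ℚ.<⇒≤ (ℚ.negative⁻¹ p)) (ℚ.0≤∣p∣ p)

∣p-q∣≡∣q-p∣ : ∀ p q → ∣ p - q ∣ ≡ ∣ q - p ∣
∣p-q∣≡∣q-p∣ p q = ≡.trans (cong ∣_∣ (solve 2 (λ p q → p :- q := :- (q :- p)) refl p q)) (ℚ.∣-p∣≡∣p∣ (q - p))
  where open +-*-Solver

q≤p+∣p-q∣ : ∀ p q → q ≤ p + ∣ p - q ∣
q≤p+∣p-q∣ p q = begin
  q                 ≡⟨ solve 2 (λ p q → q := p :+ (q :- p)) refl p q ⟩
  p + (q - p)       ≤⟨ ℚ.+-monoʳ-≤ p (p≤∣p∣ (q - p)) ⟩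
  p + ∣ q - p ∣     ≡⟨ cong (p +_) (∣p-q∣≡∣q-p∣ q p) ⟩
  p + ∣ p - q ∣     ∎
  where
  open ℚ.≤-Reasoning
  open +-*-Solver

∣p∣≤∣p-q∣+∣q∣ : ∀ p q → ∣ p ∣ ≤ ∣ p - q ∣ + ∣ q ∣
∣p∣≤∣p-q∣+∣q∣ p q = ℚ.≤-trans
  (ℚ.≤-reflexive (cong ∣_∣ (solve 2 (λ p q → p := (p :- q) :+ q) refl p q)))
  (ℚ.∣p+q∣≤∣p∣+∣q∣ (p - q) q)
  where open +-*-Solver

∣q-p∣≤r-p : ∀ {p q r} → p ≤ q → q ≤ r → ∣ q - p ∣ ≤ r - p
∣q-p∣≤r-p {p} p≤q q≤r =
  ℚ.≤-trans (ℚ.≤-reflexive (ℚ.0≤p⇒∣p∣≡p (p≤q⇒0≤q-p p≤q))) (ℚ.+-monoˡ-≤ (- p) q≤r)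

∣p*q∣≤∣q∣ : ∀ {p} q → ∣ p ∣ ≤ 1ℚ → ∣ p * q ∣ ≤ ∣ q ∣
∣p*q∣≤∣q∣ {p} q ∣p∣≤1 = begin
  ∣ p * q ∣     ≡⟨ ℚ.∣p*q∣≡∣p∣*∣q∣ p q ⟩
  ∣ p ∣ * ∣ q ∣ ≤⟨ ℚ.*-monoʳ-≤-nonNeg ∣ q ∣ {{ℚ.∣-∣-nonNeg q}} ∣p∣≤1 ⟩
  1ℚ * ∣ q ∣    ≡⟨ ℚ.*-identityˡ ∣ q ∣ ⟩
  ∣ q ∣         ∎
  where open ℚ.≤-Reasoning

∣p∣≡-p : ∀ {p} → p ≤ 0ℚ → ∣ p ∣ ≡ - p
∣p∣≡-p {p} p≤0 = ≡.trans (≡.sym (ℚ.∣-p∣≡∣p∣ p)) (ℚ.0≤p⇒∣p∣≡p (ℚ.neg-antimono-≤ p≤0))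

-1≤p≤0⇒∣p∣≤1 : ∀ {p} → - 1ℚ ≤ p → p ≤ 0ℚ → ∣ p ∣ ≤ 1ℚ
-1≤p≤0⇒∣p∣≤1 -1≤p p≤0 = ℚ.≤-trans (ℚ.≤-reflexive (∣p∣≡-p p≤0)) (ℚ.neg-antimono-≤ -1≤p)

fromℕ : ℕ → ℚ
fromℕ zero    = 0ℚ
fromℕ (suc k) = 1ℚ + fromℕ k

fromℕ-+ : ∀ m n → fromℕ (m ℕ.+ n) ≡ fromℕ m + fromℕ n
fromℕ-+ zero    n = ≡.sym (ℚ.+-identityˡ (fromℕ n))
fromℕ-+ (suc m) n = ≡.trans (cong (1ℚ +_) (fromℕ-+ m n)) (≡.sym (ℚ.+-assoc 1ℚ (fromℕ m) (fromℕ n)))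

fromℕ-double : ∀ m → fromℕ (2 ℕ.* m) ≡ fromℕ m + fromℕ m
fromℕ-double m = ≡.trans (fromℕ-+ m (m ℕ.+ 0)) (cong (λ k → fromℕ m + fromℕ k) (ℕ.+-identityʳ m))

fromℕ-* : ∀ m n → fromℕ (m ℕ.* n) ≡ fromℕ m * fromℕ n
fromℕ-* zero    n = ≡.sym (ℚ.*-zeroˡ (fromℕ n))
fromℕ-* (suc m) n = begin
  fromℕ (n ℕ.+ m ℕ.* n)         ≡⟨ fromℕ-+ n (m ℕ.* n) ⟩
  fromℕ n + fromℕ (m ℕ.* n)     ≡⟨ cong (fromℕ n +_) (fromℕ-* m n) ⟩
  fromℕ n + fromℕ m * fromℕ n   ≡⟨ solve 2 (λ m n → n :+ m :* n := (con 1ℚ :+ m) :* n) refl (fromℕ m) (fromℕ n) ⟩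
  (1ℚ + fromℕ m) * fromℕ n      ∎
  where
  open ≡-Reasoning
  open +-*-Solver

0≤fromℕ : ∀ k → 0ℚ ≤ fromℕ k
0≤fromℕ zero    = ℚ.≤-refl
0≤fromℕ (suc k) = ℚ.≤-trans (ℚ.≤ᵇ⇒≤ _) (p≤p+q 1ℚ (0≤fromℕ k))

fromℕ-mono-≤ : ∀ {m n} → m ℕ.≤ n → fromℕ m ≤ fromℕ n
fromℕ-mono-≤ {n = n} ℕ.z≤n = 0≤fromℕ n
fromℕ-mono-≤ (ℕ.s≤s m≤n)   = ℚ.+-monoʳ-≤ 1ℚ (fromℕ-mono-≤ m≤n)

module _ where
  open import Data.Integer using (+_)

  fromℕ≡fromℤ : ∀ k → fromℕ k ≡ fromℤ (+ k)
  fromℕ≡fromℤ zero    = refl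
  fromℕ≡fromℤ (suc k) = ≡.trans (cong (_+_ 1ℚ) (fromℕ≡fromℤ k))
    (ℚ.toℚᵘ-injective (ℚᵘ.≃-trans (ℚ.toℚᵘ-homo-+ 1ℚ (fromℤ (+ k))) (ℚᵘ.*≡* cross)))
    where
    cross : (+ 1 ℤ.+ + k ℤ.* + 1) ℤ.* + 1 ≡ + suc k ℤ.* + 1
    cross = cong (ℤ._* + 1) (cong (ℤ._+_ (+ 1)) (ℤ.*-identityʳ (+ k)))

fromℕ-suc*inv-suc : ∀ k → fromℕ (suc k) * inv-suc k ≡ 1ℚ
fromℕ-suc*inv-suc k = ≡.trans
  (cong₂ _*_ (fromℕ≡fromℤ (suc k)) (ℚ.normalize-coprime (1-coprimeTo (suc k))))
  (ℚ.*-inverseʳ (fromℤ (ℤ.+_ (suc k))))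

0<inv-suc : ∀ k → 0ℚ < inv-suc k
0<inv-suc k = ℚ.positive⁻¹ (inv-suc k) {{ℚ.normalize-pos 1 (suc k)}}

module _ (k : ℕ) {p : ℚ} where

  private
    p≡inv-suc*[1+k]p : p ≡ inv-suc k * (fromℕ (suc k) * p)
    p≡inv-suc*[1+k]p = begin
      p                                   ≡⟨ ≡.sym (ℚ.*-identityˡ p) ⟩
      1ℚ * p                              ≡⟨ cong (_* p) (≡.sym (fromℕ-suc*inv-suc k)) ⟩
      fromℕ (suc k) * inv-suc k * p       ≡⟨ solve 3 (λ a b p → a :* b :* p := b :* (a :* p)) refl
                                               (fromℕ (suc k)) (inv-suc k) p ⟩
      inv-suc k * (fromℕ (suc k) * p)     ∎
      where
      open ≡-Reasoning
      open +-*-Solver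

    instance
      inv-suc-nonNeg : NonNegative (inv-suc k)
      inv-suc-nonNeg = nonNegative (ℚ.<⇒≤ (0<inv-suc k))

  ≤inv-suc : fromℕ (suc k) * p ≤ 1ℚ → p ≤ inv-suc k
  ≤inv-suc [1+k]p≤1 = begin
    p                                ≡⟨ p≡inv-suc*[1+k]p ⟩
    inv-suc k * (fromℕ (suc k) * p)  ≤⟨ ℚ.*-monoˡ-≤-nonNeg (inv-suc k) [1+k]p≤1 ⟩
    inv-suc k * 1ℚ                   ≡⟨ ℚ.*-identityʳ _ ⟩
    inv-suc k                        ∎
    where open ℚ.≤-Reasoning

  inv-suc≤ : 1ℚ ≤ fromℕ (suc k) * p → inv-suc k ≤ p
  inv-suc≤ 1≤[1+k]p = begin
    inv-suc k                        ≡⟨ ≡.sym (ℚ.*-identityʳ _) ⟩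
    inv-suc k * 1ℚ                   ≤⟨ ℚ.*-monoˡ-≤-nonNeg (inv-suc k) 1≤[1+k]p ⟩
    inv-suc k * (fromℕ (suc k) * p)  ≡⟨ ≡.sym p≡inv-suc*[1+k]p ⟩
    p                                ∎
    where open ℚ.≤-Reasoning

inv-suc≤1 : ∀ k → inv-suc k ≤ 1ℚ
inv-suc≤1 k = inv-suc≤ k (ℚ.≤-trans (p≤p+q 1ℚ (0≤fromℕ k)) (ℚ.≤-reflexive (≡.sym (ℚ.*-identityʳ _))))

∃inv-suc≤ : ∀ ε → 0ℚ < ε → ∃ λ d → inv-suc d ≤ ε
∃inv-suc≤ (mkℚ ℤ.+[1+ m ] d _) _ = d , ℚ.≤-trans
  (ℚ.≤-reflexive (ℚ.normalize-coprime (1-coprimeTo (suc d))))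
  (*≤* (ℤ.*-monoʳ-≤-nonNeg (ℤ.+_ (suc d)) (ℤ.+≤+ (ℕ.s≤s (ℕ.z≤n {m})))))
∃inv-suc≤ (mkℚ (ℤ.+_ 0)    d _) 0<ε with () ← positive 0<ε
∃inv-suc≤ (mkℚ ℤ.-[1+ m ] d _) 0<ε with () ← positive 0<ε

fromℕ*inv-suc-eventually≤ : ∀ c ε → 0ℚ < ε → ∃ λ N → ∀ k → N ℕ.≤ k → fromℕ c * inv-suc k ≤ ε
fromℕ*inv-suc-eventually≤ c ε 0<ε with d , inv-suc-d≤ε ← ∃inv-suc≤ ε 0<ε =
  suc d ℕ.* c , λ k N≤k → ℚ.≤-trans (≤inv-suc d (begin
    fromℕ (suc d) * (fromℕ c * inv-suc k)  ≡⟨ ≡.sym (ℚ.*-assoc (fromℕ (suc d)) (fromℕ c) (inv-suc k)) ⟩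
    fromℕ (suc d) * fromℕ c * inv-suc k    ≡⟨ cong (_* inv-suc k) (≡.sym (fromℕ-* (suc d) c)) ⟩
    fromℕ (suc d ℕ.* c) * inv-suc k        ≤⟨ ℚ.*-monoʳ-≤-nonNeg (inv-suc k) {{nonNegative (ℚ.<⇒≤ (0<inv-suc k))}}
                                                (fromℕ-mono-≤ (ℕ.m≤n⇒m≤1+n N≤k)) ⟩
    fromℕ (suc k) * inv-suc k              ≡⟨ fromℕ-suc*inv-suc k ⟩
    1ℚ                                     ∎)) inv-suc-d≤ε
  where open ℚ.≤-Reasoning

½^k-nonNeg : ∀ k → NonNegative (½ ^ℚ k)
½^k-nonNeg zero    = _
½^k-nonNeg (suc k) = ℚ.nonNeg*nonNeg⇒nonNeg ½ (½ ^ℚ k) {{½^k-nonNeg k}}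

½^k≤inv-suc : ∀ k → ½ ^ℚ k ≤ inv-suc k
½^k≤inv-suc k = ≤inv-suc k ([1+k]½^k≤1 k)
  where
  [1+k]½^k≤1 : ∀ k → fromℕ (suc k) * ½ ^ℚ k ≤ 1ℚ
  [1+k]½^k≤1 zero    = ℚ.≤ᵇ⇒≤ _
  [1+k]½^k≤1 (suc k) = begin
    (1ℚ + fromℕ (suc k)) * (½ * ½ ^ℚ k)            ≤⟨ ℚ.*-monoʳ-≤-nonNeg (½ * ½ ^ℚ k) {{½^k-nonNeg (suc k)}}
                                                         (ℚ.+-monoˡ-≤ (fromℕ (suc k)) (p≤p+q 1ℚ (0≤fromℕ k))) ⟩
    (fromℕ (suc k) + fromℕ (suc k)) * (½ * ½ ^ℚ k) ≡⟨ solve 3 (λ a h p → (a :+ a) :* (h :* p) := a :* p :* (h :+ h))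
                                                         refl (fromℕ (suc k)) ½ (½ ^ℚ k) ⟩
    fromℕ (suc k) * ½ ^ℚ k * 1ℚ                    ≡⟨ ℚ.*-identityʳ _ ⟩
    fromℕ (suc k) * ½ ^ℚ k                         ≤⟨ [1+k]½^k≤1 k ⟩
    1ℚ                                             ∎
    where
    open ℚ.≤-Reasoning
    open +-*-Solver

-- Bisection

module Bisection {P : ℚ → Set} (P? : Decidable P) where

  record Bracket : Set where
    field
      lower upper : ℚ
      lower≤upper : lower ≤ upper
      P-lower     : P lower
      ¬P-upper    : ¬ P upper

  open Bracket public

  width : Bracket → ℚ
  width b = upper b - lower b

  midpoint : ℚ → ℚ → ℚ
  midpoint l u = l + (u - l) * ½

  module _ (l u : ℚ) where
    open +-*-Solver

    midpoint-lower : midpoint l u - l ≡ (u - l) * ½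
    midpoint-lower = solve 3 (λ l u h → (l :+ (u :- l) :* h) :- l := (u :- l) :* h) refl l u ½

    upper-midpoint : u - midpoint l u ≡ (u - l) * ½
    upper-midpoint = solve 3 (λ l u h → u :- (l :+ (u :- l) :* h) := (u :- l) :* (con 1ℚ :- h)) refl l u ½

  module _ {l u : ℚ} (l≤u : l ≤ u) where

    private
      0≤half-width : 0ℚ ≤ (u - l) * ½
      0≤half-width = ℚ.nonNegative⁻¹ _ {{ℚ.nonNeg*nonNeg⇒nonNeg (u - l) {{nonNegative (p≤q⇒0≤q-p l≤u)}} ½}}

    lower≤midpoint : l ≤ midpoint l u
    lower≤midpoint = 0≤q-p⇒p≤q (ℚ.≤-trans 0≤half-width (ℚ.≤-reflexive (≡.sym (midpoint-lower l u))))

    midpoint≤upper : midpoint l u ≤ u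
    midpoint≤upper = 0≤q-p⇒p≤q (ℚ.≤-trans 0≤half-width (ℚ.≤-reflexive (≡.sym (upper-midpoint l u))))

  split : (b : Bracket) → Dec (P (midpoint (lower b) (upper b))) → Bracket
  split b (yes Pm) = record
    { lower = midpoint (lower b) (upper b) ; upper = upper b
    ; lower≤upper = midpoint≤upper (lower≤upper b) ; P-lower = Pm ; ¬P-upper = ¬P-upper b }
  split b (no ¬Pm) = record
    { lower = lower b ; upper = midpoint (lower b) (upper b)
    ; lower≤upper = lower≤midpoint (lower≤upper b) ; P-lower = P-lower b ; ¬P-upper = ¬Pm }

  halve : Bracket → Bracket
  halve b = split b (P? (midpoint (lower b) (upper b)))

  module _ (b : Bracket) where

    lower-halve : lower b ≤ lower (halve b)
    lower-halve with P? (midpoint (lower b) (upper b))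
    ... | yes _ = lower≤midpoint (lower≤upper b)
    ... | no  _ = ℚ.≤-refl

    upper-halve : upper (halve b) ≤ upper b
    upper-halve with P? (midpoint (lower b) (upper b))
    ... | yes _ = ℚ.≤-refl
    ... | no  _ = midpoint≤upper (lower≤upper b)

    width-halve : width (halve b) ≡ width b * ½
    width-halve with P? (midpoint (lower b) (upper b))
    ... | yes _ = upper-midpoint (lower b) (upper b)
    ... | no  _ = midpoint-lower (lower b) (upper b)

  bisect : Bracket → ℕ → Bracket
  bisect b zero    = b
  bisect b (suc k) = halve (bisect b k)

  module _ (b : Bracket) where

    lower-bisect-mono : ∀ {m k} → m ℕ.≤ k → lower (bisect b m) ≤ lower (bisect b k)
    lower-bisect-mono m≤k = go (ℕ.≤⇒≤′ m≤k)
      where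
      go : ∀ {m k} → m ℕ.≤′ k → lower (bisect b m) ≤ lower (bisect b k)
      go ℕ.≤′-refl       = ℚ.≤-refl
      go (ℕ.≤′-step m≤k) = ℚ.≤-trans (go m≤k) (lower-halve _)

    upper-bisect-antitone : ∀ {m k} → m ℕ.≤ k → upper (bisect b k) ≤ upper (bisect b m)
    upper-bisect-antitone m≤k = go (ℕ.≤⇒≤′ m≤k)
      where
      go : ∀ {m k} → m ℕ.≤′ k → upper (bisect b k) ≤ upper (bisect b m)
      go ℕ.≤′-refl       = ℚ.≤-refl
      go (ℕ.≤′-step m≤k) = ℚ.≤-trans (upper-halve _) (go m≤k)

    width-bisect : ∀ k → width (bisect b k) ≡ width b * ½ ^ℚ k
    width-bisect zero    = ≡.sym (ℚ.*-identityʳ (width b))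
    width-bisect (suc k) = begin
      width (halve (bisect b k))   ≡⟨ width-halve (bisect b k) ⟩
      width (bisect b k) * ½       ≡⟨ cong (_* ½) (width-bisect k) ⟩
      width b * ½ ^ℚ k * ½         ≡⟨ solve 3 (λ w p h → w :* p :* h := w :* (h :* p)) refl (width b) (½ ^ℚ k) ½ ⟩
      width b * (½ * ½ ^ℚ k)       ∎
      where
      open ≡-Reasoning
      open +-*-Solver

    module _ (width≤1 : width b ≤ 1ℚ) where

      width-bisect≤inv-suc : ∀ k → width (bisect b k) ≤ inv-suc k
      width-bisect≤inv-suc k = begin
        width (bisect b k)   ≡⟨ width-bisect k ⟩
        width b * ½ ^ℚ k     ≤⟨ ℚ.*-monoʳ-≤-nonNeg (½ ^ℚ k) {{½^k-nonNeg k}} width≤1 ⟩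
        1ℚ * ½ ^ℚ k          ≡⟨ ℚ.*-identityˡ _ ⟩
        ½ ^ℚ k               ≤⟨ ½^k≤inv-suc k ⟩
        inv-suc k            ∎
        where open ℚ.≤-Reasoning

      lower-bisect-regular : ∀ m k →
        ∣ lower (bisect b m) - lower (bisect b k) ∣ ≤ inv-suc m + inv-suc k
      lower-bisect-regular m k with ℕ.≤-total m k
      ... | inj₁ m≤k = begin
        ∣ lower (bisect b m) - lower (bisect b k) ∣ ≡⟨ ∣p-q∣≡∣q-p∣ (lower (bisect b m)) (lower (bisect b k)) ⟩
        ∣ lower (bisect b k) - lower (bisect b m) ∣ ≤⟨ ∣q-p∣≤r-p (lower-bisect-mono m≤k)
             (ℚ.≤-trans (lower≤upper (bisect b k)) (upper-bisect-antitone m≤k)) ⟩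
        width (bisect b m)                        ≤⟨ width-bisect≤inv-suc m ⟩
        inv-suc m                                 ≤⟨ p≤p+q (inv-suc m) (ℚ.<⇒≤ (0<inv-suc k)) ⟩
        inv-suc m + inv-suc k                     ∎
        where open ℚ.≤-Reasoning
      ... | inj₂ k≤m = begin
        ∣ lower (bisect b m) - lower (bisect b k) ∣ ≤⟨ ∣q-p∣≤r-p (lower-bisect-mono k≤m)
             (ℚ.≤-trans (lower≤upper (bisect b m)) (upper-bisect-antitone k≤m)) ⟩
        width (bisect b k)                        ≤⟨ width-bisect≤inv-suc k ⟩
        inv-suc k                                 ≤⟨ p≤p+q (inv-suc k) (ℚ.<⇒≤ (0<inv-suc m)) ⟩
        inv-suc k + inv-suc m                     ≡⟨ ℚ.+-comm (inv-suc k) (inv-suc m) ⟩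
        inv-suc m + inv-suc k                     ∎
        where open ℚ.≤-Reasoning

-- Clique polynomials of induced subgraphs

-- Cliques only use adjacency in both directions, so everything below works for an arbitrary
-- Boolean relation; for a simple graph G, adjacent (adj G) is adj G.
Adjacency : ℕ → Set
Adjacency n = Fin n → Fin n → Bool

module _ {n : ℕ} where

  adjacent : Adjacency n → Fin n → Fin n → Bool
  adjacent A u v = A u v ∧ A v u

  neighbours : Adjacency n → Fin n → Subset n
  neighbours A v = tabulate λ u → not (does (u ≟ v)) ∧ adjacent A u v

  cliqueᵇ : Adjacency n → Subset n → Bool
  cliqueᵇ A K =
    allFin n λ u → allFin n λ v →
      if lookup K u ∧ lookup K v ∧ not (does (u ≟ v)) then A u v else true

  infix 4 _⊆ᵇ_
  _⊆ᵇ_ : Subset n → Subset n → Bool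
  K ⊆ᵇ W = allFin n λ u → if lookup K u then lookup W u else true

  cliqueIn : Adjacency n → Subset n → Subset n → Bool
  cliqueIn A W K = cliqueᵇ A K ∧ (K ⊆ᵇ W)

module _ {n : ℕ} (A : Adjacency (suc n)) where

  tailAdj : Adjacency n
  tailAdj u v = A (suc u) (suc v)

  tailNeighbours : Subset n
  tailNeighbours = tail (neighbours A zero)

-- C(G[W]; x, 1), expanded along vertex zero.
cliquePolyOn : ∀ {n} → Adjacency n → Subset n → ℚ → ℚ
cliquePolyOn {zero}  A []            x = 1ℚ
cliquePolyOn {suc n} A (outside ∷ W) x = cliquePolyOn (tailAdj A) W x
cliquePolyOn {suc n} A (inside  ∷ W) x =
  cliquePolyOn (tailAdj A) W x + x * cliquePolyOn (tailAdj A) (W ∩ tailNeighbours A) x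

module _ {n : ℕ} (A : Adjacency (suc n)) (K : Subset n) where

  private
    row : Fin n → Bool
    row u = allFin n λ v →
      if lookup K u ∧ lookup K v ∧ not (does (u ≟ v)) then A (suc u) (suc v) else true

    if-∧false : ∀ b c d → (if b ∧ false ∧ c then d else true) ≡ true
    if-∧false true  c d = refl
    if-∧false false c d = refl

  cliqueᵇ-outside : cliqueᵇ A (outside ∷ K) ≡ cliqueᵇ (tailAdj A) K
  cliqueᵇ-outside = cong₂ _∧_ (allFin-true n)
    (allFin-cong n λ u → cong (_∧ row u) (if-∧false (lookup K u) true (A (suc u) zero)))

  cliqueᵇ-inside : cliqueᵇ A (inside ∷ K) ≡ (K ⊆ᵇ tailNeighbours A) ∧ cliqueᵇ (tailAdj A) K
  cliqueᵇ-inside = begin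
    allFin n (λ v → if lookup K v ∧ true then A zero (suc v) else true) ∧
    allFin n (λ u → (if lookup K u ∧ true then A (suc u) zero else true) ∧ row u)
      ≡⟨ cong₂ _∧_ (allFin-cong n λ v → if-cong (∧-identityʳ (lookup K v))) (allFin-∧ n _ row) ⟩
    out ∧ (allFin n (λ u → if lookup K u ∧ true then A (suc u) zero else true) ∧ C)
      ≡⟨ cong (λ b → out ∧ (b ∧ C)) (allFin-cong n λ u → if-cong (∧-identityʳ (lookup K u))) ⟩
    out ∧ (inn ∧ C)
      ≡⟨ solve 3 (λ a b c → a :* (b :* c) := (b :* a) :* c) refl out inn C ⟩
    (inn ∧ out) ∧ C
      ≡⟨ cong (_∧ C) (≡.sym ⊆ᵇ-tailNeighbours) ⟩
    (K ⊆ᵇ tailNeighbours A) ∧ C ∎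
    where
    open ≡-Reasoning
    open ∨-∧-Solver
    C out inn : Bool
    C   = cliqueᵇ (tailAdj A) K
    out = allFin n λ v → if lookup K v then A zero (suc v) else true
    inn = allFin n λ u → if lookup K u then A (suc u) zero else true
    ⊆ᵇ-tailNeighbours : (K ⊆ᵇ tailNeighbours A) ≡ inn ∧ out
    ⊆ᵇ-tailNeighbours = ≡.trans
      (allFin-cong n λ u → ≡.trans (if-cong-then (lookup K u) (lookup∘tabulate _ u))
                                   (if-∧-distrib (lookup K u) _ _))
      (allFin-∧ n _ _)

⊆ᵇ-∩ : ∀ {n} (K W N : Subset n) → (K ⊆ᵇ W ∩ N) ≡ (K ⊆ᵇ W) ∧ (K ⊆ᵇ N)
⊆ᵇ-∩ {n} K W N = ≡.trans
  (allFin-cong n λ u → ≡.trans (if-cong-then (lookup K u) (lookup-zipWith _∧_ u W N))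
                               (if-∧-distrib (lookup K u) _ _))
  (allFin-∧ n _ _)

⊆ᵇ-⊤ : ∀ {n} (K : Subset n) → (K ⊆ᵇ ⊤) ≡ true
⊆ᵇ-⊤ {n} K = ≡.trans
  (allFin-cong n λ u → ≡.trans (if-cong-then (lookup K u) (lookup-replicate u inside)) (if-eta (lookup K u)))
  (allFin-true n)

module _ {n : ℕ} (A : Adjacency (suc n)) (w : Bool) (W K : Subset n) where

  cliqueIn-outside : cliqueIn A (w ∷ W) (outside ∷ K) ≡ cliqueIn (tailAdj A) W K
  cliqueIn-outside = cong (_∧ (K ⊆ᵇ W)) (cliqueᵇ-outside A K)

  cliqueIn-inside : cliqueIn A (w ∷ W) (inside ∷ K) ≡ w ∧ cliqueIn (tailAdj A) (W ∩ tailNeighbours A) K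
  cliqueIn-inside = begin
    cliqueᵇ A (inside ∷ K) ∧ (w ∧ (K ⊆ᵇ W))
      ≡⟨ cong (_∧ (w ∧ (K ⊆ᵇ W))) (cliqueᵇ-inside A K) ⟩
    ((K ⊆ᵇ tailNeighbours A) ∧ cliqueᵇ (tailAdj A) K) ∧ (w ∧ (K ⊆ᵇ W))
      ≡⟨ solve 4 (λ a c w b → (a :* c) :* (w :* b) := w :* (c :* (b :* a))) refl
           (K ⊆ᵇ tailNeighbours A) (cliqueᵇ (tailAdj A) K) w (K ⊆ᵇ W) ⟩
    w ∧ (cliqueᵇ (tailAdj A) K ∧ ((K ⊆ᵇ W) ∧ (K ⊆ᵇ tailNeighbours A)))
      ≡⟨ cong (λ b → w ∧ (cliqueᵇ (tailAdj A) K ∧ b)) (≡.sym (⊆ᵇ-∩ K W (tailNeighbours A))) ⟩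
    w ∧ cliqueIn (tailAdj A) (W ∩ tailNeighbours A) K ∎
    where
    open ≡-Reasoning
    open ∨-∧-Solver

cliqueSum : ∀ {n} → Adjacency n → Subset n → ℚ → ℚ
cliqueSum {n} A W x = sumOver (λ K → if cliqueIn A W K then x ^ℚ size K else 0ℚ) (allSubsets n)

cliqueSum-∷ : ∀ {n} (A : Adjacency (suc n)) w W x →
  cliqueSum A (w ∷ W) x ≡
  cliqueSum (tailAdj A) W x +
  sumOver (λ K → if w ∧ cliqueIn (tailAdj A) (W ∩ tailNeighbours A) K then x * x ^ℚ size K else 0ℚ)
          (allSubsets n)
cliqueSum-∷ {n} A w W x = begin
  sumOver f (map (outside ∷_) (allSubsets n) ++ map (inside ∷_) (allSubsets n))
    ≡⟨ sumOver-++ f (map (outside ∷_) (allSubsets n)) (map (inside ∷_) (allSubsets n)) ⟩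
  sumOver f (map (outside ∷_) (allSubsets n)) + sumOver f (map (inside ∷_) (allSubsets n))
    ≡⟨ cong₂ _+_ (≡.trans (sumOver-map f (outside ∷_) (allSubsets n))
                          (sumOver-cong (λ K → if-cong (cliqueIn-outside A w W K)) (allSubsets n)))
                 (≡.trans (sumOver-map f (inside ∷_) (allSubsets n))
                          (sumOver-cong (λ K → if-cong (cliqueIn-inside A w W K)) (allSubsets n))) ⟩
  cliqueSum (tailAdj A) W x +
  sumOver (λ K → if w ∧ cliqueIn (tailAdj A) (W ∩ tailNeighbours A) K then x * x ^ℚ size K else 0ℚ)
          (allSubsets n) ∎
  where
  open ≡-Reasoning
  f : Subset (suc n) → ℚ
  f K = if cliqueIn A (w ∷ W) K then x ^ℚ size K else 0ℚ

cliqueSum≡cliquePolyOn : ∀ {n} (A : Adjacency n) W x → cliqueSum A W x ≡ cliquePolyOn A W x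
cliqueSum≡cliquePolyOn {zero}  A []            x = ℚ.+-identityʳ 1ℚ
cliqueSum≡cliquePolyOn {suc n} A (outside ∷ W) x = begin
  cliqueSum A (outside ∷ W) x
    ≡⟨ cliqueSum-∷ A outside W x ⟩
  cliqueSum (tailAdj A) W x + sumOver (λ _ → 0ℚ) (allSubsets n)
    ≡⟨ cong₂ _+_ (cliqueSum≡cliquePolyOn (tailAdj A) W x) (sumOver-0 (allSubsets n)) ⟩
  cliquePolyOn (tailAdj A) W x + 0ℚ
    ≡⟨ ℚ.+-identityʳ _ ⟩
  cliquePolyOn (tailAdj A) W x ∎
  where open ≡-Reasoning
cliqueSum≡cliquePolyOn {suc n} A (inside ∷ W) x = begin
  cliqueSum A (inside ∷ W) x
    ≡⟨ cliqueSum-∷ A inside W x ⟩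
  cliqueSum (tailAdj A) W x + sumOver (λ K → if c K then x * x ^ℚ size K else 0ℚ) (allSubsets n)
    ≡⟨ cong (cliqueSum (tailAdj A) W x +_)
         (≡.trans (sumOver-cong (λ K → if-*ˡ (c K) x (x ^ℚ size K)) (allSubsets n))
                  (sumOver-*ˡ x (λ K → if c K then x ^ℚ size K else 0ℚ) (allSubsets n))) ⟩
  cliqueSum (tailAdj A) W x + x * cliqueSum (tailAdj A) (W ∩ tailNeighbours A) x
    ≡⟨ cong₂ (λ p q → p + x * q) (cliqueSum≡cliquePolyOn (tailAdj A) W x)
                                 (cliqueSum≡cliquePolyOn (tailAdj A) (W ∩ tailNeighbours A) x) ⟩
  cliquePolyOn A (inside ∷ W) x ∎
  where
  open ≡-Reasoning
  c : Subset n → Bool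
  c = cliqueIn (tailAdj A) (W ∩ tailNeighbours A)
  if-*ˡ : ∀ b p q → (if b then p * q else 0ℚ) ≡ p * (if b then q else 0ℚ)
  if-*ˡ true  p q = refl
  if-*ˡ false p q = ≡.sym (ℚ.*-zeroʳ p)

cliquePoly≡cliquePolyOn : ∀ {n} (G : SimpleGraph n) B x → cliquePoly G B x 1ℚ ≡ cliquePolyOn (adj G) ⊤ x
cliquePoly≡cliquePolyOn {n} G B x =
  ≡.trans (sumOver-cong term (allSubsets n)) (cliqueSum≡cliquePolyOn (adj G) ⊤ x)
  where
  term : ∀ K → (if isClique G K then x ^ℚ size K * 1ℚ ^ℚ size (K ∩ B) else 0ℚ)
             ≡ (if cliqueIn (adj G) ⊤ K then x ^ℚ size K else 0ℚ)
  term K = cong₂ (λ b y → if b then y else 0ℚ)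
    (≡.sym (≡.trans (cong (cliqueᵇ (adj G) K ∧_) (⊆ᵇ-⊤ K)) (∧-identityʳ _)))
    (≡.trans (cong (x ^ℚ size K *_) (1^ℚk≡1 (size (K ∩ B)))) (ℚ.*-identityʳ _))

-- Deleting a vertex

module _ {n : ℕ} (A : Adjacency n) where

  adjacent-sym : ∀ u v → adjacent A u v ≡ adjacent A v u
  adjacent-sym u v = ∧-comm (A u v) (A v u)

  ∈-neighbours⁻ : ∀ {u v} → u ∈ neighbours A v → adjacent A u v ≡ true
  ∈-neighbours⁻ {u} {v} u∈N =
    ∧-conicalʳ (not (does (u ≟ v))) _ (≡.trans (≡.sym (lookup∘tabulate _ u)) ([]=⇒lookup u∈N))

  ∈-neighbours⁺ : ∀ {u v} → u ≢ v → adjacent A u v ≡ true → u ∈ neighbours A v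
  ∈-neighbours⁺ {u} {v} u≢v u~v = lookup⇒[]= u _ (≡.trans (lookup∘tabulate _ u)
    (cong₂ _∧_ (cong not (dec-false (u ≟ v) u≢v)) u~v))

cliquePolyOn-delete : ∀ {n} (A : Adjacency n) {W v} x → v ∈ W →
  cliquePolyOn A W x ≡ cliquePolyOn A (W ─ ⁅ v ⁆) x + x * cliquePolyOn A (W ∩ neighbours A v) x
cliquePolyOn-delete A {inside ∷ W} {zero} x here =
  cong (λ X → cliquePolyOn (tailAdj A) X x + x * cliquePolyOn (tailAdj A) (W ∩ tailNeighbours A) x)
       (≡.sym (p─⊥≡p W))
cliquePolyOn-delete A {outside ∷ W} {suc v} x (there v∈W) = cliquePolyOn-delete (tailAdj A) x v∈W
cliquePolyOn-delete A {inside  ∷ W} {suc v} x (there v∈W) = expand (adjacent A zero (suc v)) refl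
  where
  open ≡-Reasoning
  open +-*-Solver
  Q : Subset _ → ℚ
  Q X = cliquePolyOn (tailAdj A) X x
  N₀ = tailNeighbours A
  Nᵥ = neighbours (tailAdj A) v
  W-v = W ─ ⁅ v ⁆
  expand : ∀ b → adjacent A zero (suc v) ≡ b →
    Q W + x * Q (W ∩ N₀) ≡ cliquePolyOn A (inside ∷ W-v) x + x * cliquePolyOn A (b ∷ (W ∩ Nᵥ)) x
  expand false 0≁v = begin
    Q W + x * Q (W ∩ N₀)
      ≡⟨ cong (_+ x * Q (W ∩ N₀)) (cliquePolyOn-delete (tailAdj A) x v∈W) ⟩
    (Q W-v + x * Q (W ∩ Nᵥ)) + x * Q (W ∩ N₀)
      ≡⟨ solve 4 (λ a b c x → (a :+ x :* b) :+ x :* c := (a :+ x :* c) :+ x :* b) refl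
           (Q W-v) (Q (W ∩ Nᵥ)) (Q (W ∩ N₀)) x ⟩
    (Q W-v + x * Q (W ∩ N₀)) + x * Q (W ∩ Nᵥ)
      ≡⟨ cong (λ X → (Q W-v + x * Q X) + x * Q (W ∩ Nᵥ))
              (≡.sym (≡.trans (─-∩ W ⁅ v ⁆ N₀) (x∉p⇒p─⁅x⁆≡p v∉W∩N₀))) ⟩
    (Q W-v + x * Q (W-v ∩ N₀)) + x * Q (W ∩ Nᵥ) ∎
    where
    v∉W∩N₀ : v ∉ W ∩ N₀
    v∉W∩N₀ v∈W∩N₀ with () ← ≡.trans (≡.sym 0≁v) (≡.trans (adjacent-sym A zero (suc v))
                              (∈-neighbours⁻ A (there (proj₂ (x∈p∩q⁻ W N₀ v∈W∩N₀)))))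
  expand true 0~v = begin
    Q W + x * Q (W ∩ N₀)
      ≡⟨ cong₂ (λ p q → p + x * q) (cliquePolyOn-delete (tailAdj A) x v∈W)
                                   (cliquePolyOn-delete (tailAdj A) x v∈W∩N₀) ⟩
    (Q W-v + x * Q (W ∩ Nᵥ)) + x * (Q ((W ∩ N₀) ─ ⁅ v ⁆) + x * Q ((W ∩ N₀) ∩ Nᵥ))
      ≡⟨ solve 5 (λ a b c d x → (a :+ x :* b) :+ x :* (c :+ x :* d) := (a :+ x :* c) :+ x :* (b :+ x :* d))
           refl (Q W-v) (Q (W ∩ Nᵥ)) (Q ((W ∩ N₀) ─ ⁅ v ⁆)) (Q ((W ∩ N₀) ∩ Nᵥ)) x ⟩
    (Q W-v + x * Q ((W ∩ N₀) ─ ⁅ v ⁆)) + x * (Q (W ∩ Nᵥ) + x * Q ((W ∩ N₀) ∩ Nᵥ))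
      ≡⟨ cong₂ (λ X Y → (Q W-v + x * Q X) + x * (Q (W ∩ Nᵥ) + x * Q Y))
           (≡.sym (─-∩ W ⁅ v ⁆ N₀)) (∩-∩-comm W N₀ Nᵥ) ⟩
    (Q W-v + x * Q (W-v ∩ N₀)) + x * (Q (W ∩ Nᵥ) + x * Q ((W ∩ Nᵥ) ∩ N₀)) ∎
    where
    v∈W∩N₀ : v ∈ W ∩ N₀
    v∈W∩N₀ = x∈p∩q⁺ (v∈W , drop-there (∈-neighbours⁺ A (λ ()) (≡.trans (adjacent-sym A (suc v) zero) 0~v)))

AllPositive : ∀ {n} → Adjacency n → ℚ → Set
AllPositive A x = ∀ W → 0ℚ < cliquePolyOn A W x

module _ {n : ℕ} (A : Adjacency n) {x : ℚ} (x≤0 : x ≤ 0ℚ) (pos : AllPositive A x) where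

  cliquePolyOn-delete-≤ : ∀ {W v} → v ∈ W → cliquePolyOn A W x ≤ cliquePolyOn A (W ─ ⁅ v ⁆) x
  cliquePolyOn-delete-≤ {W} {v} v∈W = begin
    cliquePolyOn A W x                   ≡⟨ cliquePolyOn-delete A x v∈W ⟩
    cliquePolyOn A (W ─ ⁅ v ⁆) x + x * q ≤⟨ ℚ.+-monoʳ-≤ (cliquePolyOn A (W ─ ⁅ v ⁆) x) x*q≤0 ⟩
    cliquePolyOn A (W ─ ⁅ v ⁆) x + 0ℚ    ≡⟨ ℚ.+-identityʳ _ ⟩
    cliquePolyOn A (W ─ ⁅ v ⁆) x         ∎
    where
    open ℚ.≤-Reasoning
    q = cliquePolyOn A (W ∩ neighbours A v) x
    x*q≤0 : x * q ≤ 0ℚ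
    x*q≤0 = ℚ.≤-trans (ℚ.*-monoʳ-≤-nonNeg q {{nonNegative (ℚ.<⇒≤ (pos _))}} x≤0)
                      (ℚ.≤-reflexive (ℚ.*-zeroˡ q))

  cliquePolyOn-antitone : ∀ {P W} → P ⊆ W → cliquePolyOn A W x ≤ cliquePolyOn A P x
  cliquePolyOn-antitone {P} {W} = go (⊂-wellFounded W)
    where
    go : ∀ {W} → Acc _⊂_ W → P ⊆ W → cliquePolyOn A W x ≤ cliquePolyOn A P x
    go {W} (acc rec) P⊆W with nonempty? (W ─ P)
    ... | no  W─P-empty = ℚ.≤-reflexive (cong (λ X → cliquePolyOn A X x) (⊆-antisym W⊆P P⊆W))
      where
      W⊆P : W ⊆ P
      W⊆P {u} u∈W with u ∈? P
      ... | yes u∈P = u∈P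
      ... | no  u∉P = ⊥-elim (W─P-empty (u , x∈p∧x∉q⇒x∈p─q u∈W u∉P))
    ... | yes (v , v∈W─P) = ℚ.≤-trans (cliquePolyOn-delete-≤ v∈W) (go (rec (x∈p⇒p-x⊂p v∈W)) P⊆W-v)
      where
      v∈W = p─q⊆p W P v∈W─P
      P⊆W-v : P ⊆ W ─ ⁅ v ⁆
      P⊆W-v u∈P = x∈p∧x≢y⇒x∈p-y (P⊆W u∈P) λ { refl → x∈p─q⇒x∉q W P v∈W─P u∈P }

cliquePolyOn-0 : ∀ {n} (A : Adjacency n) W → cliquePolyOn A W 0ℚ ≡ 1ℚ
cliquePolyOn-0 {zero}  A []            = refl
cliquePolyOn-0 {suc n} A (outside ∷ W) = cliquePolyOn-0 (tailAdj A) W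
cliquePolyOn-0 {suc n} A (inside  ∷ W) = ≡.trans
  (cong₂ _+_ (cliquePolyOn-0 (tailAdj A) W) (ℚ.*-zeroˡ (cliquePolyOn (tailAdj A) (W ∩ tailNeighbours A) 0ℚ)))
  (ℚ.+-identityʳ 1ℚ)

cliquePolyOn-⊥ : ∀ {n} (A : Adjacency n) x → cliquePolyOn A ⊥ x ≡ 1ℚ
cliquePolyOn-⊥ {zero}  A x = refl
cliquePolyOn-⊥ {suc n} A x = cliquePolyOn-⊥ (tailAdj A) x

Independent : ∀ {n} → Adjacency n → Subset n → Set
Independent A I = ∀ {u v} → u ∈ I → v ∈ I → A u v ≡ false

cliquePolyOn-independent : ∀ {n} (A : Adjacency n) {I} x → Independent A I →
  cliquePolyOn A I x ≡ 1ℚ + fromℕ (size I) * x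
cliquePolyOn-independent {zero}  A {[]}          x indep =
  ≡.sym (≡.trans (cong (1ℚ +_) (ℚ.*-zeroˡ x)) (ℚ.+-identityʳ 1ℚ))
cliquePolyOn-independent {suc n} A {outside ∷ I} x indep =
  cliquePolyOn-independent (tailAdj A) x λ u∈I v∈I → indep (there u∈I) (there v∈I)
cliquePolyOn-independent {suc n} A {inside  ∷ I} x indep = begin
  cliquePolyOn (tailAdj A) I x + x * cliquePolyOn (tailAdj A) (I ∩ N₀) x
    ≡⟨ cong₂ (λ p X → p + x * cliquePolyOn (tailAdj A) X x)
         (cliquePolyOn-independent (tailAdj A) x λ u∈I v∈I → indep (there u∈I) (there v∈I))
         (Empty-unique I∩N₀-empty) ⟩
  (1ℚ + fromℕ (size I) * x) + x * cliquePolyOn (tailAdj A) ⊥ x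
    ≡⟨ cong (λ q → (1ℚ + fromℕ (size I) * x) + x * q) (cliquePolyOn-⊥ (tailAdj A) x) ⟩
  (1ℚ + fromℕ (size I) * x) + x * 1ℚ
    ≡⟨ solve 2 (λ k x → (con 1ℚ :+ k :* x) :+ x :* con 1ℚ := con 1ℚ :+ (con 1ℚ :+ k) :* x)
         refl (fromℕ (size I)) x ⟩
  1ℚ + (1ℚ + fromℕ (size I)) * x ∎
  where
  open ≡-Reasoning
  open +-*-Solver
  N₀ = tailNeighbours A
  I∩N₀-empty : ¬ (∃ λ u → u ∈ I ∩ N₀)
  I∩N₀-empty (u , u∈I∩N₀) with () ← ≡.trans (≡.sym (indep (there (proj₁ (x∈p∩q⁻ I N₀ u∈I∩N₀))) here))
    (∧-conicalˡ _ _ (∈-neighbours⁻ A (there (proj₂ (x∈p∩q⁻ I N₀ u∈I∩N₀)))))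

cliquePolyOn-bound : ∀ {n} (A : Adjacency n) W {x} → ∣ x ∣ ≤ 1ℚ →
  ∣ cliquePolyOn A W x ∣ ≤ fromℕ (2 ℕ.^ n)
cliquePolyOn-bound {zero}  A []            ∣x∣≤1 = ℚ.≤-refl
cliquePolyOn-bound {suc n} A (outside ∷ W) ∣x∣≤1 = begin
  ∣ cliquePolyOn (tailAdj A) W _ ∣    ≤⟨ cliquePolyOn-bound (tailAdj A) W ∣x∣≤1 ⟩
  fromℕ (2 ℕ.^ n)                     ≤⟨ p≤p+q _ (0≤fromℕ (2 ℕ.^ n)) ⟩
  fromℕ (2 ℕ.^ n) + fromℕ (2 ℕ.^ n)   ≡⟨ ≡.sym (fromℕ-double (2 ℕ.^ n)) ⟩
  fromℕ (2 ℕ.^ suc n)                 ∎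
  where open ℚ.≤-Reasoning
cliquePolyOn-bound {suc n} A (inside ∷ W) {x} ∣x∣≤1 = begin
  ∣ g + x * h ∣                       ≤⟨ ℚ.∣p+q∣≤∣p∣+∣q∣ g (x * h) ⟩
  ∣ g ∣ + ∣ x * h ∣                   ≤⟨ ℚ.+-mono-≤ (cliquePolyOn-bound (tailAdj A) W ∣x∣≤1)
                                          (ℚ.≤-trans (∣p*q∣≤∣q∣ h ∣x∣≤1) (cliquePolyOn-bound (tailAdj A) _ ∣x∣≤1)) ⟩
  fromℕ (2 ℕ.^ n) + fromℕ (2 ℕ.^ n)   ≡⟨ ≡.sym (fromℕ-double (2 ℕ.^ n)) ⟩
  fromℕ (2 ℕ.^ suc n)                 ∎
  where
  open ℚ.≤-Reasoning
  g = cliquePolyOn (tailAdj A) W x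
  h = cliquePolyOn (tailAdj A) (W ∩ tailNeighbours A) x

lipschitz : ℕ → ℕ
lipschitz zero    = 0
lipschitz (suc n) = 2 ℕ.* lipschitz n ℕ.+ 2 ℕ.^ n

fromℕ-lipschitz : ∀ n →
  fromℕ (lipschitz (suc n)) ≡ fromℕ (lipschitz n) + fromℕ (lipschitz n) + fromℕ (2 ℕ.^ n)
fromℕ-lipschitz n = ≡.trans (fromℕ-+ (2 ℕ.* lipschitz n) (2 ℕ.^ n))
                            (cong (_+ fromℕ (2 ℕ.^ n)) (fromℕ-double (lipschitz n)))

cliquePolyOn-lipschitz : ∀ {n} (A : Adjacency n) W {x y} → ∣ x ∣ ≤ 1ℚ → ∣ y ∣ ≤ 1ℚ →
  ∣ cliquePolyOn A W x - cliquePolyOn A W y ∣ ≤ fromℕ (lipschitz n) * ∣ x - y ∣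
cliquePolyOn-lipschitz {zero}  A []            {x} {y} _ _ =
  ℚ.≤-reflexive (≡.sym (ℚ.*-zeroˡ ∣ x - y ∣))
cliquePolyOn-lipschitz {suc n} A (outside ∷ W) {x} {y} ∣x∣≤1 ∣y∣≤1 = begin
  ∣ cliquePolyOn (tailAdj A) W x - cliquePolyOn (tailAdj A) W y ∣
    ≤⟨ cliquePolyOn-lipschitz (tailAdj A) W ∣x∣≤1 ∣y∣≤1 ⟩
  L * ∣ x - y ∣
    ≤⟨ ℚ.*-monoʳ-≤-nonNeg ∣ x - y ∣ {{ℚ.∣-∣-nonNeg (x - y)}}
         (ℚ.≤-trans (p≤p+q L (0≤fromℕ (lipschitz n))) (p≤p+q (L + L) (0≤fromℕ (2 ℕ.^ n)))) ⟩
  (L + L + fromℕ (2 ℕ.^ n)) * ∣ x - y ∣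
    ≡⟨ cong (_* ∣ x - y ∣) (≡.sym (fromℕ-lipschitz n)) ⟩
  fromℕ (lipschitz (suc n)) * ∣ x - y ∣ ∎
  where
  open ℚ.≤-Reasoning
  L = fromℕ (lipschitz n)
cliquePolyOn-lipschitz {suc n} A (inside ∷ W) {x} {y} ∣x∣≤1 ∣y∣≤1 = begin
  ∣ (g x + x * h x) - (g y + y * h y) ∣
    ≡⟨ cong ∣_∣ (solve 6 (λ gx gy hx hy x y → (gx :+ x :* hx) :- (gy :+ y :* hy)
                            := ((gx :- gy) :+ x :* (hx :- hy)) :+ (x :- y) :* hy)
                   refl (g x) (g y) (h x) (h y) x y) ⟩
  ∣ ((g x - g y) + x * (h x - h y)) + (x - y) * h y ∣
    ≤⟨ ℚ.≤-trans (ℚ.∣p+q∣≤∣p∣+∣q∣ ((g x - g y) + x * (h x - h y)) ((x - y) * h y))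
                 (ℚ.+-monoˡ-≤ ∣ (x - y) * h y ∣ (ℚ.∣p+q∣≤∣p∣+∣q∣ (g x - g y) (x * (h x - h y)))) ⟩
  ∣ g x - g y ∣ + ∣ x * (h x - h y) ∣ + ∣ (x - y) * h y ∣
    ≤⟨ ℚ.+-mono-≤ (ℚ.+-mono-≤ (cliquePolyOn-lipschitz (tailAdj A) W ∣x∣≤1 ∣y∣≤1)
                              (ℚ.≤-trans (∣p*q∣≤∣q∣ (h x - h y) ∣x∣≤1)
                                         (cliquePolyOn-lipschitz (tailAdj A) _ ∣x∣≤1 ∣y∣≤1)))
                  ∣[x-y]*hy∣≤ ⟩
  L * d + L * d + fromℕ (2 ℕ.^ n) * d
    ≡⟨ solve 3 (λ L B d → L :* d :+ L :* d :+ B :* d := (L :+ L :+ B) :* d) refl L (fromℕ (2 ℕ.^ n)) d ⟩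
  (L + L + fromℕ (2 ℕ.^ n)) * d
    ≡⟨ cong (_* d) (≡.sym (fromℕ-lipschitz n)) ⟩
  fromℕ (lipschitz (suc n)) * d ∎
  where
  open ℚ.≤-Reasoning
  open +-*-Solver
  g h : ℚ → ℚ
  g = cliquePolyOn (tailAdj A) W
  h = cliquePolyOn (tailAdj A) (W ∩ tailNeighbours A)
  L d : ℚ
  L = fromℕ (lipschitz n)
  d = ∣ x - y ∣
  ∣[x-y]*hy∣≤ : ∣ (x - y) * h y ∣ ≤ fromℕ (2 ℕ.^ n) * d
  ∣[x-y]*hy∣≤ = begin
    ∣ (x - y) * h y ∣   ≡⟨ ℚ.∣p*q∣≡∣p∣*∣q∣ (x - y) (h y) ⟩
    d * ∣ h y ∣         ≤⟨ ℚ.*-monoˡ-≤-nonNeg d {{ℚ.∣-∣-nonNeg (x - y)}} (cliquePolyOn-bound (tailAdj A) _ ∣y∣≤1) ⟩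
    d * fromℕ (2 ℕ.^ n) ≡⟨ ℚ.*-comm d _ ⟩
    fromℕ (2 ℕ.^ n) * d ∎

-- A negative root

module _ {n : ℕ} (A : Adjacency n) where

  HasNonpositive : ℚ → Set
  HasNonpositive x = ∃ λ W → cliquePolyOn A W x ≤ 0ℚ

  hasNonpositive? : Decidable HasNonpositive
  hasNonpositive? x = anySubset? λ W → cliquePolyOn A W x ℚ.≤? 0ℚ

  ¬HasNonpositive⇒AllPositive : ∀ {x} → ¬ HasNonpositive x → AllPositive A x
  ¬HasNonpositive⇒AllPositive ¬h W = ℚ.≰⇒> λ Q≤0 → ¬h (W , Q≤0)

  private
    L : ℚ
    L = fromℕ (lipschitz n)

  cliquePolyOn-≤-lipschitz : ∀ W {x y} → ∣ x ∣ ≤ 1ℚ → ∣ y ∣ ≤ 1ℚ →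
    cliquePolyOn A W y ≤ cliquePolyOn A W x + L * ∣ x - y ∣
  cliquePolyOn-≤-lipschitz W {x} {y} ∣x∣≤1 ∣y∣≤1 = ℚ.≤-trans
    (q≤p+∣p-q∣ (cliquePolyOn A W x) (cliquePolyOn A W y))
    (ℚ.+-monoʳ-≤ (cliquePolyOn A W x) (cliquePolyOn-lipschitz A W ∣x∣≤1 ∣y∣≤1))

  cliquePolyOn-⊤-near-root : ∀ {x y} → ∣ x ∣ ≤ 1ℚ → ∣ y ∣ ≤ 1ℚ → y ≤ 0ℚ →
    HasNonpositive x → ¬ HasNonpositive y → ∣ cliquePolyOn A ⊤ x ∣ ≤ (L + L) * ∣ x - y ∣
  cliquePolyOn-⊤-near-root {x} {y} ∣x∣≤1 ∣y∣≤1 y≤0 (W , QWx≤0) ¬h = begin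
    ∣ Q ⊤ x ∣                       ≤⟨ ∣p∣≤∣p-q∣+∣q∣ (Q ⊤ x) (Q ⊤ y) ⟩
    ∣ Q ⊤ x - Q ⊤ y ∣ + ∣ Q ⊤ y ∣   ≤⟨ ℚ.+-mono-≤ (cliquePolyOn-lipschitz A ⊤ ∣x∣≤1 ∣y∣≤1) ∣Q⊤y∣≤ ⟩
    L * ∣ x - y ∣ + L * ∣ x - y ∣   ≡⟨ ≡.sym (ℚ.*-distribʳ-+ ∣ x - y ∣ L L) ⟩
    (L + L) * ∣ x - y ∣             ∎
    where
    open ℚ.≤-Reasoning
    Q : Subset n → ℚ → ℚ
    Q = cliquePolyOn A
    pos : AllPositive A y
    pos = ¬HasNonpositive⇒AllPositive ¬h
    ∣Q⊤y∣≤ : ∣ Q ⊤ y ∣ ≤ L * ∣ x - y ∣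
    ∣Q⊤y∣≤ = begin
      ∣ Q ⊤ y ∣             ≡⟨ ℚ.0≤p⇒∣p∣≡p (ℚ.<⇒≤ (pos ⊤)) ⟩
      Q ⊤ y                 ≤⟨ cliquePolyOn-antitone A y≤0 pos ⊆⊤ ⟩
      Q W y                 ≤⟨ cliquePolyOn-≤-lipschitz W ∣x∣≤1 ∣y∣≤1 ⟩
      Q W x + L * ∣ x - y ∣ ≤⟨ ℚ.+-monoˡ-≤ (L * ∣ x - y ∣) QWx≤0 ⟩
      0ℚ + L * ∣ x - y ∣    ≡⟨ ℚ.+-identityˡ _ ⟩
      L * ∣ x - y ∣         ∎

  HasNonpositive⇒≤-inv-suc : ∀ {x} → ∣ x ∣ ≤ 1ℚ → x ≤ 0ℚ → HasNonpositive x →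
    x ≤ - inv-suc (lipschitz n)
  HasNonpositive⇒≤-inv-suc {x} ∣x∣≤1 x≤0 (W , QWx≤0) = ℚ.≤-trans
    (ℚ.≤-reflexive (solve 1 (λ x → x := :- (:- x)) refl x))
    (ℚ.neg-antimono-≤ (inv-suc≤ (lipschitz n) (begin
      1ℚ                                  ≡⟨ ≡.sym (cliquePolyOn-0 A W) ⟩
      cliquePolyOn A W 0ℚ                 ≤⟨ cliquePolyOn-≤-lipschitz W ∣x∣≤1 (ℚ.≤ᵇ⇒≤ _) ⟩
      cliquePolyOn A W x + L * ∣ x - 0ℚ ∣ ≤⟨ ℚ.+-monoˡ-≤ _ QWx≤0 ⟩
      0ℚ + L * ∣ x - 0ℚ ∣                 ≡⟨ ≡.trans (ℚ.+-identityˡ _) (cong (λ t → L * ∣ t ∣) (ℚ.+-identityʳ x)) ⟩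
      L * ∣ x ∣                           ≡⟨ cong (L *_) (∣p∣≡-p x≤0) ⟩
      L * - x                             ≤⟨ ℚ.*-monoʳ-≤-nonNeg (- x) {{nonNegative (ℚ.neg-antimono-≤ x≤0)}}
                                               (ℚ.≤-trans (p≤p+q L (ℚ.≤ᵇ⇒≤ _)) (ℚ.≤-reflexive (ℚ.+-comm L 1ℚ))) ⟩
      fromℕ (suc (lipschitz n)) * - x     ∎)))
    where
    open ℚ.≤-Reasoning
    open +-*-Solver

module _ {n : ℕ} (A : Adjacency n) {I : Subset n} (I-indep : Independent A I)
         {a : ℕ} (∣I∣≡1+a : size I ≡ suc a) where

  open Bisection (hasNonpositive? A)

  private
    -1/[1+a] : ℚ
    -1/[1+a] = - inv-suc a

    initial : Bracket
    initial = record
      { lower       = -1/[1+a]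
      ; upper       = 0ℚ
      ; lower≤upper = ℚ.neg-antimono-≤ (ℚ.<⇒≤ (0<inv-suc a))
      ; P-lower     = I , ℚ.≤-reflexive (begin
          cliquePolyOn A I -1/[1+a]        ≡⟨ cliquePolyOn-independent A -1/[1+a] I-indep ⟩
          1ℚ + fromℕ (size I) * -1/[1+a]   ≡⟨ cong (λ k → 1ℚ + fromℕ k * -1/[1+a]) ∣I∣≡1+a ⟩
          1ℚ + fromℕ (suc a) * -1/[1+a]    ≡⟨ cong (1ℚ +_) (≡.sym (ℚ.neg-distribʳ-* (fromℕ (suc a)) (inv-suc a))) ⟩
          1ℚ - fromℕ (suc a) * inv-suc a   ≡⟨ cong (_-_ 1ℚ) (fromℕ-suc*inv-suc a) ⟩
          1ℚ - 1ℚ                          ≡⟨ ℚ.+-inverseʳ 1ℚ ⟩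
          0ℚ                               ∎)
      ; ¬P-upper    = λ (W , QW0≤0) → ℚ.<-irrefl refl
          (ℚ.<-≤-trans (ℚ.positive⁻¹ 1ℚ) (ℚ.≤-trans (ℚ.≤-reflexive (≡.sym (cliquePolyOn-0 A W))) QW0≤0))
      }
      where open ≡-Reasoning

    width-initial≤1 : width initial ≤ 1ℚ
    width-initial≤1 = ℚ.≤-trans (ℚ.≤-reflexive (solve 1 (λ p → con 0ℚ :- (:- p) := p) refl (inv-suc a)))
                                (inv-suc≤1 a)
      where open +-*-Solver

    lower-bisect≥ : ∀ k → -1/[1+a] ≤ lower (bisect initial k)
    lower-bisect≥ k = lower-bisect-mono initial {k = k} ℕ.z≤n

    upper-bisect≤0 : ∀ k → upper (bisect initial k) ≤ 0ℚ
    upper-bisect≤0 k = upper-bisect-antitone initial {k = k} ℕ.z≤n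

    lower-bisect≤0 : ∀ k → lower (bisect initial k) ≤ 0ℚ
    lower-bisect≤0 k = ℚ.≤-trans (lower≤upper (bisect initial k)) (upper-bisect≤0 k)

    -1≤lower-bisect : ∀ k → - 1ℚ ≤ lower (bisect initial k)
    -1≤lower-bisect k = ℚ.≤-trans (ℚ.neg-antimono-≤ (inv-suc≤1 a)) (lower-bisect≥ k)

    ∣lower-bisect∣≤1 : ∀ k → ∣ lower (bisect initial k) ∣ ≤ 1ℚ
    ∣lower-bisect∣≤1 k = -1≤p≤0⇒∣p∣≤1 (-1≤lower-bisect k) (lower-bisect≤0 k)

    ∣upper-bisect∣≤1 : ∀ k → ∣ upper (bisect initial k) ∣ ≤ 1ℚ
    ∣upper-bisect∣≤1 k = -1≤p≤0⇒∣p∣≤1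
      (ℚ.≤-trans (-1≤lower-bisect k) (lower≤upper (bisect initial k))) (upper-bisect≤0 k)

    2L : ℕ
    2L = lipschitz n ℕ.+ lipschitz n

    cliquePolyOn-⊤-lower-bisect : ∀ k →
      ∣ cliquePolyOn A ⊤ (lower (bisect initial k)) ∣ ≤ fromℕ 2L * inv-suc k
    cliquePolyOn-⊤-lower-bisect k = begin
      ∣ cliquePolyOn A ⊤ l ∣
        ≤⟨ cliquePolyOn-⊤-near-root A (∣lower-bisect∣≤1 k) (∣upper-bisect∣≤1 k) (upper-bisect≤0 k)
                                      (P-lower b) (¬P-upper b) ⟩
      (fromℕ (lipschitz n) + fromℕ (lipschitz n)) * ∣ l - u ∣
        ≡⟨ cong₂ _*_ (≡.sym (fromℕ-+ (lipschitz n) (lipschitz n)))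
                     (≡.trans (∣p-q∣≡∣q-p∣ l u) (ℚ.0≤p⇒∣p∣≡p (p≤q⇒0≤q-p (lower≤upper b)))) ⟩
      fromℕ 2L * width b
        ≤⟨ ℚ.*-monoˡ-≤-nonNeg (fromℕ 2L) {{nonNegative (0≤fromℕ 2L)}}
                              (width-bisect≤inv-suc initial width-initial≤1 k) ⟩
      fromℕ 2L * inv-suc k ∎
      where
      open ℚ.≤-Reasoning
      b = bisect initial k
      l = lower b
      u = upper b

  cliquePolyOn-negativeRoot : NegativeRootAbove (cliquePolyOn A ⊤) (- inv-suc a)
  cliquePolyOn-negativeRoot = record
    { s        = λ k → lower (bisect initial k)
    ; regular  = lower-bisect-regular initial width-initial≤1
    ; root     = λ ε 0<ε → let (N , ≤ε) = fromℕ*inv-suc-eventually≤ 2L ε 0<ε in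
                   N , λ k N≤k → ℚ.≤-trans (cliquePolyOn-⊤-lower-bisect k) (≤ε k N≤k)
    ; δ        = inv-suc (lipschitz n)
    ; δ-pos    = 0<inv-suc (lipschitz n)
    ; negative = λ k → HasNonpositive⇒≤-inv-suc A (∣lower-bisect∣≤1 k) (lower-bisect≤0 k)
                                                  (P-lower (bisect initial k))
    ; above    = lower-bisect≥
    }

NegativeRootAbove-cong : ∀ {p q : ℚ → ℚ} {c} → (∀ x → p x ≡ q x) →
  NegativeRootAbove p c → NegativeRootAbove q c
NegativeRootAbove-cong p≗q r = record
  { s = s ; regular = regular ; δ = δ ; δ-pos = δ-pos ; negative = negative ; above = above
  ; root = λ ε 0<ε → proj₁ (root ε 0<ε) , λ k N≤k →
      ≡.subst (λ t → ∣ t ∣ ≤ ε) (p≗q (s k)) (proj₂ (root ε 0<ε) k N≤k)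
  }
  where open NegativeRootAbove r

foldr-⊔-attained : ∀ {X : Set} (f : X → ℕ) xs {m} → foldr (λ x → f x ℕ.⊔_) 0 xs ≡ suc m →
  ∃ λ x → f x ≡ suc m
foldr-⊔-attained f (x ∷ xs) eq with ℕ.⊔-sel (f x) (foldr (λ x → f x ℕ.⊔_) 0 xs)
... | inj₁ ⊔≡fx   = x , ≡.trans (≡.sym ⊔≡fx) eq
... | inj₂ ⊔≡rest = foldr-⊔-attained f xs (≡.trans (≡.sym ⊔≡rest) eq)

module _ {n : ℕ} (G : SimpleGraph n) (B : Subset n) where

  alphaB-attained : ∀ {a} → alphaB G B ≡ suc a →
    ∃ λ I → isBIndependent G B I ≡ true × size I ≡ suc a
  alphaB-attained α≡1+a
    with I , eq ← foldr-⊔-attained (λ I → if isBIndependent G B I then size I else 0) (allSubsets n) α≡1+a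
    with isBIndependent G B I in indep
  ... | true = I , indep , eq

  isBIndependent⇒Independent : ∀ {I} → isBIndependent G B I ≡ true → Independent (adj G) I
  isBIndependent⇒Independent {I} indep {u} {v} u∈I v∈I = not-injective (begin
    not (adj G u v)
      ≡⟨ ≡.sym (if-cong (cong₂ _∧_ ([]=⇒lookup u∈I) ([]=⇒lookup v∈I))) ⟩
    (if lookup I u ∧ lookup I v then not (adj G u v) else true)
      ≡⟨ allFin-elim n (allFin-elim n (∧-conicalʳ _ _ indep) u) v ⟩
    true ∎)
    where open ≡-Reasoning

proposition3p1 : (n : ℕ) (G : SimpleGraph n) (B : Subset n) →
    1 ℕ.≤ alphaB G B →
    NegativeRootAbove (λ x → cliquePoly G B x 1ℚ) (negRecip (alphaB G B))
proposition3p1 n G B _ with alphaB G B in α≡1+a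
-- The abstracted hypothesis 1 ≤ alphaB G B rules out the case zero.
... | suc a with I , indep , ∣I∣≡1+a ← alphaB-attained G B α≡1+a =
  NegativeRootAbove-cong (λ x → ≡.sym (cliquePoly≡cliquePolyOn G B x))
    (cliquePolyOn-negativeRoot (adj G) (isBIndependent⇒Independent G B {I} indep) ∣I∣≡1+a)
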